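{- Let $s\in\{\mathtt{0},\mathtt{1}\}^{\mathbb{Z}}$ be a balanced sequence having at least one factorization $s=\widetilde{p}xyp$ with $\{x,y\}=\{\mathtt{0},\mathtt{1}\}$, where $p$ is a right-infinite word and $\widetilde{p}$ its reversal. Let $n\ge1$ and let $w$ be the prefix of $p$ of length $n-1$. Then the two words $\widetilde{w}\mathtt{0}\mathtt{1}w$ and $\widetilde{w}\mathtt{1}\mathtt{0}w$ of length $2n$ contain the $n+1$ factors of length $n$ of $s$; more precisely, $\mathcal{L}_n(s)=\mathcal{L}_n(\widetilde{w}\mathtt{0}\mathtt{1}w)=\mathcal{L}_n(\widetilde{w}\mathtt{1}\mathtt{0}w)$.
   Context: For a (finite or biinfinite) word $z$, $\mathcal{L}_n(z)$ is the set of factors (contiguous subwords) of $z$ of length $n$. $s$ is balanced if for every $n\ge1$, any two factors of $s$ of length $n$ have numbers of occurrences of each letter differing by at most 1. The reversal of a finite word $w_1\cdots w_n$ is $\widetilde{w}=w_n\cdots w_1$; the reversal of a right-infinite word $p=p_0p_1p_2\cdots$ is the left-infinite word $\widetilde{p}=\cdots p_2p_1p_0$; $s=\widetilde{p}xyp$ means $s$ is the concatenation of these, up to the position of the origin. -}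

module Defs where

open import Data.Bool using (Bool; true; false; _≟_)
open import Data.Nat using (ℕ; _≤_; ∣_-_∣)
open import Data.Integer using (ℤ; +_; _+_; _-_; 1ℤ)
open import Data.Fin using (Fin; toℕ)
open import Data.Vec using (Vec; lookup; toList; count)
open import Data.List using (List; _∷_; _++_; reverse; map; upTo)
open import Data.Product using (Σ; _×_; ∃; ∃₂)
open import Relation.Binary.PropositionalEquality using (_≡_; _≢_)

-- Alphabet {0,1} encoded as Bool: 0 = false, 1 = true.

BiSeq : Set
BiSeq = ℤ → Bool

RSeq : Set
RSeq = ℕ → Bool

IsFactor : (s : BiSeq) {n : ℕ} → Vec Bool n → Set
IsFactor s {n} u = ∃ λ (i : ℤ) → (j : Fin n) → lookup u j ≡ s (i + + toℕ j)

IsFinFactor : List Bool → {n : ℕ} → Vec Bool n → Set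
IsFinFactor z u = ∃₂ λ (a b : List Bool) → z ≡ a ++ toList u ++ b

occ : Bool → {n : ℕ} → Vec Bool n → ℕ
occ a u = count (_≟ a) u

Balanced : BiSeq → Set
Balanced s = (n : ℕ) → 1 ≤ n → (u v : Vec Bool n) → IsFactor s u → IsFactor s v →
  (a : Bool) → ∣ occ a u - occ a v ∣ ≤ 1

-- s = p̃ x y p (up to the position of the origin): for some k,
-- s(k) = x, s(k+1) = y, s(k-1-i) = p i and s(k+2+i) = p i for all i,
-- and {x,y} = {0,1}, i.e. x ≢ y.
Factorization : BiSeq → RSeq → Bool → Bool → Set
Factorization s p x y = x ≢ y × ∃ λ (k : ℤ) →
  s k ≡ x × s (k + 1ℤ) ≡ y ×
  ((i : ℕ) → s (k - 1ℤ - + i) ≡ p i × s (k + + 2 + + i) ≡ p i)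

prefix : RSeq → ℕ → List Bool
prefix p m = map p (upTo m)

wrap : List Bool → Bool → Bool → List Bool
wrap w a b = reverse w ++ a ∷ b ∷ w

{-# OPTIONS --safe #-}
-- Translate s so that x y sits at positions 0 and 1; then g(-1-i) = g(2+i) = pᵢ, and the window
-- g[-m, m+2) is w̃ x y w. Balance forbids a z a and ā z ā from both being factors (their numbers of 1s
-- differ by 2). In a factorial, extendable binary language without such pairs there is at most one right
-- special factor of each length, and the language is closed under reversal. By induction on m every factor
-- of length m+1 occurs in the window: if v b has length m+2 and v occurs in the window, either b continues
-- that occurrence, or v is right special and hence v = g[-(m+1), 0), whose continuations by x (at 0) and
-- by y (by the mirror symmetry) both lie in the next window. Reversal closure then swaps x y into y x.
module Submission where

open import Defs
open import Data.Bool using (Bool; true; false; not; _≟_)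
open import Data.Bool.Properties using (¬-not; not-¬)
open import Data.Nat as ℕ using (ℕ; zero; suc; _≤_; _<_; _∸_; z≤n; s≤s; ∣_-_∣)
import Data.Nat.Properties as ℕₚ
open import Data.Integer using (ℤ; +_; -_; _+_; _-_; 0ℤ; 1ℤ; -1ℤ)
import Data.Integer.Properties as ℤₚ
open import Data.Integer.Tactic.RingSolver using (solve-∀)
open import Data.List using (List; []; _∷_; _++_; _∷ʳ_; reverse; length; map; upTo; applyUpTo; initLast; _∷ʳ′_)
import Data.List.Properties as Listₚ
open import Data.Vec as Vec using (Vec; []; _∷_; lookup; toList; fromList)
import Data.Vec.Properties as Vecₚ
open import Data.Fin as Fin using (toℕ)
open import Data.Product using (∃; ∃₂; _×_; _,_; proj₁; proj₂)
open import Data.Unit using (⊤; tt)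
open import Data.Empty using (⊥; ⊥-elim)
open import Relation.Nullary using (¬_; yes; no)
open import Function using (_∘_)
open import Function.Bundles using (_⇔_; mk⇔; Equivalence)
import Function.Properties.Equivalence as ⇔
open import Relation.Binary.PropositionalEquality

distinct-elim : ∀ {x y} (P : Bool → Set) → x ≢ y → P x → P y → ∀ a → P a
distinct-elim {x} {y} P x≢y px py a with a ≟ x
... | yes refl = px
... | no a≢x = subst P (trans (¬-not (x≢y ∘ sym)) (sym (¬-not a≢x))) py

length-∷ʳ : ∀ {A : Set} (l : List A) a → length (l ∷ʳ a) ≡ suc (length l)
length-∷ʳ l a = trans (Listₚ.length-++ l) (ℕₚ.+-comm (length l) 1)

Infix : {A : Set} → List A → List A → Set
Infix {A} z l = ∃₂ λ (a b : List A) → z ≡ a ++ l ++ b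

infix-reverse : ∀ {A : Set} (z l : List A) → Infix z l → Infix (reverse z) (reverse l)
infix-reverse _ l (a , b , refl) = reverse b , reverse a , (begin
    reverse (a ++ l ++ b)                 ≡⟨ Listₚ.reverse-++ a (l ++ b) ⟩
    reverse (l ++ b) ++ reverse a         ≡⟨ cong (_++ reverse a) (Listₚ.reverse-++ l b) ⟩
    (reverse b ++ reverse l) ++ reverse a ≡⟨ Listₚ.++-assoc (reverse b) (reverse l) (reverse a) ⟩
    reverse b ++ reverse l ++ reverse a   ∎)
  where open ≡-Reasoning

infix⇔reverse : ∀ {A : Set} (z l : List A) → Infix z l ⇔ Infix (reverse z) (reverse l)
infix⇔reverse z l = mk⇔ (infix-reverse z l)
  (subst₂ Infix (Listₚ.reverse-involutive z) (Listₚ.reverse-involutive l) ∘ infix-reverse (reverse z) (reverse l))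

wrap-reverse : ∀ (w : List Bool) a b → reverse (wrap w a b) ≡ wrap w b a
wrap-reverse w a b = begin
    reverse (reverse w ++ a ∷ b ∷ w)               ≡⟨ Listₚ.reverse-++ (reverse w) (a ∷ b ∷ w) ⟩
    reverse (a ∷ b ∷ w) ++ reverse (reverse w)     ≡⟨ cong₂ _++_ (Listₚ.reverse-++ (a ∷ b ∷ []) w) (Listₚ.reverse-involutive w) ⟩
    (reverse w ++ b ∷ a ∷ []) ++ w                 ≡⟨ Listₚ.++-assoc (reverse w) (b ∷ a ∷ []) w ⟩
    reverse w ++ b ∷ a ∷ w                         ∎
  where open ≡-Reasoning

+-suc-assoc : ∀ i n → i + 1ℤ + + n ≡ i + + suc n
+-suc-assoc i n = ℤₚ.+-assoc i 1ℤ (+ n)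

module Occurrences {A : Set} (g : ℤ → A) where

  OccursAt : ℤ → List A → Set
  OccursAt i []      = ⊤
  OccursAt i (a ∷ l) = g i ≡ a × OccursAt (i + 1ℤ) l

  Factor : List A → Set
  Factor l = ∃ λ i → OccursAt i l

  occursAt-++⁻ : ∀ i l r → OccursAt i (l ++ r) → OccursAt i l × OccursAt (i + + length l) r
  occursAt-++⁻ i []      r o       = tt , subst (λ j → OccursAt j r) (sym (ℤₚ.+-identityʳ i)) o
  occursAt-++⁻ i (a ∷ l) r (e , o) =
    let ol , or = occursAt-++⁻ (i + 1ℤ) l r o
    in (e , ol) , subst (λ j → OccursAt j r) (+-suc-assoc i (length l)) or

  occursAt-++⁺ : ∀ i l r → OccursAt i l → OccursAt (i + + length l) r → OccursAt i (l ++ r)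
  occursAt-++⁺ i []      r _        or = subst (λ j → OccursAt j r) (ℤₚ.+-identityʳ i) or
  occursAt-++⁺ i (a ∷ l) r (e , ol) or =
    e , occursAt-++⁺ (i + 1ℤ) l r ol (subst (λ j → OccursAt j r) (sym (+-suc-assoc i (length l))) or)

  occursAt-∷ʳ : ∀ i l → OccursAt i l → OccursAt i (l ∷ʳ g (i + + length l))
  occursAt-∷ʳ i l o = occursAt-++⁺ i l _ o (refl , tt)

  occursAt-agree : ∀ i j l → OccursAt i l → OccursAt j l → ∀ t → t < length l → g (i + + t) ≡ g (j + + t)
  occursAt-agree i j (a ∷ l) (ei , _) (ej , _) zero _ = begin
    g (i + 0ℤ) ≡⟨ cong g (ℤₚ.+-identityʳ i) ⟩
    g i        ≡⟨ trans ei (sym ej) ⟩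
    g j        ≡⟨ cong g (sym (ℤₚ.+-identityʳ j)) ⟩
    g (j + 0ℤ) ∎
    where open ≡-Reasoning
  occursAt-agree i j (a ∷ l) (_ , oi) (_ , oj) (suc t) (s≤s t<l) = begin
    g (i + + suc t)      ≡⟨ cong g (sym (+-suc-assoc i t)) ⟩
    g (i + 1ℤ + + t)     ≡⟨ occursAt-agree (i + 1ℤ) (j + 1ℤ) l oi oj t t<l ⟩
    g (j + 1ℤ + + t)     ≡⟨ cong g (+-suc-assoc j t) ⟩
    g (j + + suc t)      ∎
    where open ≡-Reasoning

  factor-∷⁻ : ∀ a l → Factor (a ∷ l) → Factor l
  factor-∷⁻ a l (i , _ , o) = i + 1ℤ , o

  factor-∷ʳ⁻ : ∀ l a → Factor (l ∷ʳ a) → Factor l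
  factor-∷ʳ⁻ l a (i , o) = i , proj₁ (occursAt-++⁻ i l (a ∷ []) o)

  factor-extendˡ : ∀ l → Factor l → ∃ λ a → Factor (a ∷ l)
  factor-extendˡ l (i , o) = g (i - 1ℤ) , i - 1ℤ , refl , subst (λ j → OccursAt j l) (sym (i-1+1 i)) o
    where
    i-1+1 : ∀ i → i - 1ℤ + 1ℤ ≡ i
    i-1+1 = solve-∀

  factor-extendʳ : ∀ l → Factor l → ∃ λ a → Factor (l ∷ʳ a)
  factor-extendʳ l (i , o) = _ , i , occursAt-∷ʳ i l o

  segment : ℤ → ℕ → List A
  segment i zero    = []
  segment i (suc n) = g i ∷ segment (i + 1ℤ) n

  length-segment : ∀ i n → length (segment i n) ≡ n
  length-segment i zero    = refl
  length-segment i (suc n) = cong suc (length-segment (i + 1ℤ) n)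

  occursAt-segment : ∀ i n → OccursAt i (segment i n)
  occursAt-segment i zero    = tt
  occursAt-segment i (suc n) = refl , occursAt-segment (i + 1ℤ) n

  occursAt⇒segment : ∀ i l → OccursAt i l → segment i (length l) ≡ l
  occursAt⇒segment i []      _       = refl
  occursAt⇒segment i (a ∷ l) (e , o) = cong₂ _∷_ e (occursAt⇒segment (i + 1ℤ) l o)

  segment-++ : ∀ i m n → segment i (m ℕ.+ n) ≡ segment i m ++ segment (i + + m) n
  segment-++ i zero    n = cong (λ j → segment j n) (sym (ℤₚ.+-identityʳ i))
  segment-++ i (suc m) n = cong (g i ∷_) (begin
    segment (i + 1ℤ) (m ℕ.+ n)                          ≡⟨ segment-++ (i + 1ℤ) m n ⟩
    segment (i + 1ℤ) m ++ segment (i + 1ℤ + + m) n      ≡⟨ cong (λ j → segment (i + 1ℤ) m ++ segment j n) (+-suc-assoc i m) ⟩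
    segment (i + 1ℤ) m ++ segment (i + + suc m) n       ∎)
    where open ≡-Reasoning

  segment-applyUpTo : ∀ i (f : ℕ → A) n → (∀ t → g (i + + t) ≡ f t) → segment i n ≡ applyUpTo f n
  segment-applyUpTo i f zero    _  = refl
  segment-applyUpTo i f (suc n) eq =
    cong₂ _∷_ (trans (cong g (sym (ℤₚ.+-identityʳ i))) (eq 0))
              (segment-applyUpTo (i + 1ℤ) (f ∘ suc) n (λ t → trans (cong g (+-suc-assoc i t)) (eq (suc t))))

  infix-segment⇒factor : ∀ i n l → Infix (segment i n) l → Factor l
  infix-segment⇒factor i n l (a , b , eq) =
    let o = proj₂ (occursAt-++⁻ i a (l ++ b) (subst (OccursAt i) eq (occursAt-segment i n)))
    in _ , proj₁ (occursAt-++⁻ _ l b o)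

RightSpecial : (List Bool → Set) → List Bool → Set
RightSpecial L v = ∀ a → L (v ∷ʳ a)

NoBadPair : (List Bool → Set) → Set
NoBadPair L = ∀ a z → L (a ∷ z ∷ʳ a) → L (not a ∷ z ∷ʳ not a) → ⊥

module NoBadPairLanguage (L : List Bool → Set)
  (drop-head : ∀ a l → L (a ∷ l) → L l) (drop-last : ∀ l a → L (l ∷ʳ a) → L l)
  (extendˡ : ∀ l → L l → ∃ λ a → L (a ∷ l)) (extendʳ : ∀ l → L l → ∃ λ a → L (l ∷ʳ a))
  (noBadPair : NoBadPair L) where

  rightSpecial : ∀ v a → L (v ∷ʳ a) → L (v ∷ʳ not a) → RightSpecial L v
  rightSpecial v a = distinct-elim (λ c → L (v ∷ʳ c)) (not-¬ refl)

  rightSpecial-unique : ∀ v w → length v ≡ length w → RightSpecial L v → RightSpecial L w → v ≡ w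
  rightSpecial-unique []      []      _   _  _  = refl
  rightSpecial-unique (a ∷ v) (b ∷ w) len Rv Rw
    with refl ← rightSpecial-unique v w (ℕₚ.suc-injective len) (drop-head a _ ∘ Rv) (drop-head b _ ∘ Rw)
    with a ≟ b
  ... | yes refl = refl
  ... | no a≢b   = ⊥-elim (noBadPair a v (Rv a) (subst (λ c → L (c ∷ v ∷ʳ not a)) (¬-not (a≢b ∘ sym)) (Rw (not a))))

  module _ (n : ℕ) (ih : ∀ l → length l ≡ suc n → L l → L (reverse l)) where

    reverse-∷ : ∀ a l → length l ≡ n → L (a ∷ l) → L (reverse l ∷ʳ a)
    reverse-∷ a l len Lal = subst L (Listₚ.unfold-reverse a l) (ih (a ∷ l) (cong suc len) Lal)

    reverse-∷ʳ : ∀ l a → length l ≡ n → L (l ∷ʳ a) → L (a ∷ reverse l)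
    reverse-∷ʳ l a len Lla =
      subst L (Listₚ.reverse-++ l (a ∷ [])) (ih (l ∷ʳ a) (trans (length-∷ʳ l a) (cong suc len)) Lla)

    -- Both m and its reversal are right special, so they are equal.
    palindrome : ∀ a m → length m ≡ n →
                   L (not a ∷ reverse m ∷ʳ a) → L (a ∷ reverse m ∷ʳ not a) → m ≡ reverse m
    palindrome a m len L₁ L₂ = rightSpecial-unique m (reverse m) (sym (Listₚ.length-reverse m))
      (rightSpecial m a (reverse-twice a (drop-last _ (not a) L₂)) (reverse-twice (not a) (drop-last _ a L₁)))
      (rightSpecial (reverse m) a (drop-head (not a) _ L₁) (drop-head a _ L₂))
      where
      reverse-twice : ∀ c → L (c ∷ reverse m) → L (m ∷ʳ c)
      reverse-twice c Lc = subst (λ v → L (v ∷ʳ c)) (Listₚ.reverse-involutive m)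
        (reverse-∷ c (reverse m) (trans (Listₚ.length-reverse m) len) Lc)

    -- Extend (reverse m) a to the left and b (reverse m) to the right; if neither extension is the one wanted,
    -- then either a ≠ b and the two extensions form a bad pair, or a = b and m is a palindrome.
    reverse-closed-ends : ∀ a m b → length m ≡ n → L (a ∷ m ∷ʳ b) → L (b ∷ reverse m ∷ʳ a)
    reverse-closed-ends a m b len Lamb
      with extendˡ _ (reverse-∷ a m len (drop-last _ b Lamb))
         | extendʳ _ (reverse-∷ʳ m b len (drop-head a _ Lamb))
    ... | c , Lc | d , Ld with c ≟ b | d ≟ a
    ... | yes refl | _        = Lc
    ... | no _     | yes refl = Ld
    ... | no c≢b   | no d≢a with refl ← ¬-not c≢b | refl ← ¬-not d≢a | a ≟ b
    ...   | yes refl = subst (λ v → L (a ∷ v ∷ʳ a)) (palindrome a m len Lc Ld) Lamb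
    ...   | no a≢b   = ⊥-elim (noBadPair a (reverse m)
                         (subst (λ v → L (v ∷ reverse m ∷ʳ a)) (sym (¬-not a≢b)) Lc)
                         (subst (λ v → L (v ∷ reverse m ∷ʳ not a)) (¬-not (a≢b ∘ sym)) Ld))

    reverse-closed-step : ∀ l → length l ≡ suc (suc n) → L l → L (reverse l)
    reverse-closed-step (a ∷ l) len Ll with initLast l
    ... | m ∷ʳ′ b = subst L (sym reverse-ends) (reverse-closed-ends a m b length-m Ll)
      where
      length-m : length m ≡ n
      length-m = ℕₚ.suc-injective (trans (sym (length-∷ʳ m b)) (ℕₚ.suc-injective len))
      reverse-ends : reverse (a ∷ m ∷ʳ b) ≡ b ∷ reverse m ∷ʳ a
      reverse-ends = trans (Listₚ.unfold-reverse a (m ∷ʳ b)) (cong (_∷ʳ a) (Listₚ.reverse-++ m (b ∷ [])))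

  reverse-closed-length : ∀ n l → length l ≡ n → L l → L (reverse l)
  reverse-closed-length zero          []       _ Ll = Ll
  reverse-closed-length (suc zero)    (a ∷ []) _ Ll = Ll
  reverse-closed-length (suc (suc n)) = reverse-closed-step n (reverse-closed-length (suc n))

  reverse-closed : ∀ l → L l → L (reverse l)
  reverse-closed l = reverse-closed-length (length l) l refl

  reverse-closed⇔ : ∀ l → L l ⇔ L (reverse l)
  reverse-closed⇔ l = mk⇔ (reverse-closed l) (subst L (Listₚ.reverse-involutive l) ∘ reverse-closed (reverse l))

module _ (s : BiSeq) where
  open Occurrences s

  occursAt-toList⁺ : ∀ {n} (u : Vec Bool n) i → (∀ j → lookup u j ≡ s (i + + toℕ j)) → OccursAt i (toList u)
  occursAt-toList⁺ []      i _  = tt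
  occursAt-toList⁺ (a ∷ u) i eq =
    sym (trans (eq Fin.zero) (cong s (ℤₚ.+-identityʳ i))) ,
    occursAt-toList⁺ u (i + 1ℤ) (λ j → trans (eq (Fin.suc j)) (cong s (sym (+-suc-assoc i (toℕ j)))))

  occursAt-toList⁻ : ∀ {n} (u : Vec Bool n) i → OccursAt i (toList u) → ∀ j → lookup u j ≡ s (i + + toℕ j)
  occursAt-toList⁻ (a ∷ u) i (e , _) Fin.zero    = sym (trans (cong s (ℤₚ.+-identityʳ i)) e)
  occursAt-toList⁻ (a ∷ u) i (_ , o) (Fin.suc j) =
    trans (occursAt-toList⁻ u (i + 1ℤ) o j) (cong s (+-suc-assoc i (toℕ j)))

  isFactor⇔factor : ∀ {n} (u : Vec Bool n) → IsFactor s u ⇔ Factor (toList u)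
  isFactor⇔factor u = mk⇔ (λ (i , eq) → i , occursAt-toList⁺ u i eq)
                          (λ (i , o) → i , occursAt-toList⁻ u i o)

occ-∷ʳ : ∀ {n} a (v : Vec Bool n) → occ true (v Vec.∷ʳ a) ≡ occ true (a ∷ v)
occ-∷ʳ a     []          = refl
occ-∷ʳ true  (true  ∷ v) = cong suc (occ-∷ʳ true v)
occ-∷ʳ true  (false ∷ v) = occ-∷ʳ true v
occ-∷ʳ false (true  ∷ v) = cong suc (occ-∷ʳ false v)
occ-∷ʳ false (false ∷ v) = occ-∷ʳ false v

∣2+n-n∣≡2 : ∀ n → ∣ 2 ℕ.+ n - n ∣ ≡ 2
∣2+n-n∣≡2 zero    = refl
∣2+n-n∣≡2 (suc n) = ∣2+n-n∣≡2 n

occ-gap-bad-pair : ∀ {n} a (v : Vec Bool n) → ∣ occ true (a ∷ (v Vec.∷ʳ a)) - occ true (not a ∷ (v Vec.∷ʳ not a)) ∣ ≡ 2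
occ-gap-bad-pair true  v rewrite occ-∷ʳ true v | occ-∷ʳ false v = ∣2+n-n∣≡2 (occ true v)
occ-gap-bad-pair false v rewrite occ-∷ʳ true v | occ-∷ʳ false v =
  trans (ℕₚ.∣-∣-comm (occ true v) (2 ℕ.+ occ true v)) (∣2+n-n∣≡2 (occ true v))

balanced⇒noBadPair : ∀ s → Balanced s → NoBadPair (Occurrences.Factor s)
balanced⇒noBadPair s bal a z F₁ F₂ =
  2≰1 (subst (_≤ 1) (occ-gap-bad-pair a (fromList z)) (bal _ (s≤s z≤n) (word a) (word (not a)) (isFactor F₁) (isFactor F₂) true))
  where
  open Occurrences s
  word : Bool → Vec Bool (suc (suc (length z)))
  word c = c ∷ (fromList z Vec.∷ʳ c)
  isFactor : ∀ {c} → Factor (c ∷ z ∷ʳ c) → IsFactor s (word c)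
  isFactor {c} F = Equivalence.from (isFactor⇔factor s (word c)) (subst Factor (sym toList-word) F)
    where
    toList-word : toList (word c) ≡ c ∷ z ∷ʳ c
    toList-word = cong (c ∷_) (trans (Vecₚ.toList-∷ʳ c (fromList z)) (cong (_∷ʳ c) (Vecₚ.toList∘fromList z)))
  2≰1 : ¬ 2 ≤ 1
  2≰1 (s≤s ())

module Window (g : ℤ → Bool) (p : RSeq) {x y : Bool} (x≢y : x ≢ y) (g0 : g 0ℤ ≡ x) (g1 : g 1ℤ ≡ y)
              (g-left : ∀ i → g (-1ℤ - + i) ≡ p i) (g-right : ∀ i → g (+ 2 + + i) ≡ p i)
              (noBadPair : NoBadPair (Occurrences.Factor g)) where

  open Occurrences g
  open NoBadPairLanguage Factor factor-∷⁻ factor-∷ʳ⁻ factor-extendˡ factor-extendʳ noBadPair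

  start : ℕ → ℕ → ℤ
  start m e = - + m + + e

  -- u occurs inside g[-m, m + 2), which spells w̃ x y w for w the prefix of p of length m (window≡wrap).
  InWindow : ℕ → List Bool → Set
  InWindow m u = ∃ λ e → e ≤ suc m × OccursAt (start m e) u

  left : ℕ → List Bool
  left m = segment (- + m) m

  start-suc : ∀ m e → start (suc m) (suc e) ≡ start m e
  start-suc m e = lemma (+ m) (+ e)
    where
    lemma : ∀ a b → - (1ℤ + a) + (1ℤ + b) ≡ - a + b
    lemma = solve-∀

  inWindow⇒factor : ∀ m u → InWindow m u → Factor u
  inWindow⇒factor m u (e , _ , o) = start m e , o

  inWindow-∷ʳ : ∀ m e u → e ≤ suc m → length u ≡ suc m → OccursAt (start m e) u →
                InWindow (suc m) (u ∷ʳ g (start m e + + suc m))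
  inWindow-∷ʳ m e u e≤ len o = suc e , s≤s e≤ , subst₂ OccursAt (sym (start-suc m e))
    (cong (λ n → u ∷ʳ g (start m e + + n)) len) (occursAt-∷ʳ (start m e) u o)

  -- For m = e + r this occurrence of left (m + 1) = g[-(m+1), 0) starts at 1 - r, so it aligns position 1
  -- with -1 - e, whose mirror image 2 + e is the position right after the occurrence.
  letter-after-left : ∀ m e → e ≤ suc m → OccursAt (start m e) (left (suc m)) → g (start m e + + suc m) ≡ y
  letter-after-left m zero _ _ = trans (cong g (lemma (+ m))) g1
    where
    lemma : ∀ a → - a + 0ℤ + (1ℤ + a) ≡ 1ℤ
    lemma = solve-∀
  letter-after-left m (suc e) (s≤s e≤m) o with r , refl ← ℕₚ.m≤n⇒∃[o]m+o≡n e≤m = begin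
    g (start (e ℕ.+ r) (suc e) + + suc (e ℕ.+ r)) ≡⟨ cong g (next (+ e) (+ r)) ⟩
    g (+ 2 + + e)                                 ≡⟨ trans (g-right e) (sym (g-left e)) ⟩
    g (-1ℤ - + e)                                 ≡⟨ cong g (sym (mirror (+ e) (+ r))) ⟩
    g (- + suc (e ℕ.+ r) + + r)                   ≡⟨ sym (occursAt-agree _ _ (left (suc (e ℕ.+ r))) o
                                                        (occursAt-segment _ _) r r<length) ⟩
    g (start (e ℕ.+ r) (suc e) + + r)             ≡⟨ cong g (one (+ e) (+ r)) ⟩
    g 1ℤ                                          ≡⟨ g1 ⟩
    y                                             ∎
    where
    open ≡-Reasoning
    next : ∀ a b → - (a + b) + (1ℤ + a) + (1ℤ + (a + b)) ≡ + 2 + a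
    next = solve-∀
    mirror : ∀ a b → - (1ℤ + (a + b)) + b ≡ -1ℤ - a
    mirror = solve-∀
    one : ∀ a b → - (a + b) + (1ℤ + a) + b ≡ 1ℤ
    one = solve-∀
    r<length : r < length (left (suc (e ℕ.+ r)))
    r<length rewrite length-segment (- + suc (e ℕ.+ r)) (suc (e ℕ.+ r)) = s≤s (ℕₚ.m≤n+m r e)

  left∷ʳx-inWindow : ∀ m → InWindow (suc m) (left (suc m) ∷ʳ x)
  left∷ʳx-inWindow m = 0 , z≤n ,
    subst₂ OccursAt (sym (ℤₚ.+-identityʳ i)) (cong (left (suc m) ∷ʳ_) next≡x) (occursAt-∷ʳ i _ (occursAt-segment i (suc m)))
    where
    i = - + suc m
    next≡x : g (i + + length (left (suc m))) ≡ x
    next≡x = trans (cong g (trans (cong (λ n → i + + n) (length-segment i (suc m))) (ℤₚ.+-inverseˡ (+ suc m)))) g0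

  left∷ʳy-inWindow : ∀ m → InWindow m (left (suc m)) → InWindow (suc m) (left (suc m) ∷ʳ y)
  left∷ʳy-inWindow m (e , e≤ , o) = subst (λ c → InWindow (suc m) (left (suc m) ∷ʳ c)) (letter-after-left m e e≤ o)
    (inWindow-∷ʳ m e (left (suc m)) e≤ (length-segment (- + suc m) (suc m)) o)

  left∷ʳ-inWindow : ∀ m → InWindow m (left (suc m)) → ∀ b → InWindow (suc m) (left (suc m) ∷ʳ b)
  left∷ʳ-inWindow m w = distinct-elim (λ c → InWindow (suc m) (left (suc m) ∷ʳ c)) x≢y (left∷ʳx-inWindow m) (left∷ʳy-inWindow m w)

  module _ (m : ℕ) (ih : ∀ u → length u ≡ suc m → Factor u → InWindow m u) where

    factor∷ʳ⇒inWindow : ∀ v b → length v ≡ suc m → Factor (v ∷ʳ b) → InWindow (suc m) (v ∷ʳ b)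
    factor∷ʳ⇒inWindow v b len F with ih v len (factor-∷ʳ⁻ v b F)
    ... | e , e≤ , o with b ≟ g (start m e + + suc m)
    ...   | yes refl = inWindow-∷ʳ m e v e≤ len o
    ...   | no b≢c   = subst (λ w → InWindow (suc m) (w ∷ʳ b)) (sym v≡left) (left∷ʳ-inWindow m left-inWindow b)
      where
      left-inWindow : InWindow m (left (suc m))
      left-inWindow = ih (left (suc m)) (length-segment (- + suc m) (suc m)) (_ , occursAt-segment (- + suc m) (suc m))
      v≡left : v ≡ left (suc m)
      v≡left = rightSpecial-unique v (left (suc m)) (trans len (sym (length-segment (- + suc m) (suc m))))
        (distinct-elim (λ a → Factor (v ∷ʳ a)) b≢c F (inWindow⇒factor _ _ (inWindow-∷ʳ m e v e≤ len o)))
        (λ a → inWindow⇒factor _ _ (left∷ʳ-inWindow m left-inWindow a))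

    factor⇒inWindow-step : ∀ u → length u ≡ suc (suc m) → Factor u → InWindow (suc m) u
    factor⇒inWindow-step u len F with initLast u
    ... | v ∷ʳ′ b = factor∷ʳ⇒inWindow v b (ℕₚ.suc-injective (trans (sym (length-∷ʳ v b)) len)) F

  factor⇒inWindow : ∀ m u → length u ≡ suc m → Factor u → InWindow m u
  factor⇒inWindow zero    (a ∷ []) _ _ =
    distinct-elim (λ c → InWindow 0 (c ∷ [])) x≢y (0 , z≤n , g0 , tt) (1 , s≤s z≤n , g1 , tt) a
  factor⇒inWindow (suc m) = factor⇒inWindow-step m (factor⇒inWindow m)

  window : ℕ → List Bool
  window m = segment (- + m) (m ℕ.+ (2 ℕ.+ m))

  inWindow⇒infix : ∀ m u → length u ≡ suc m → InWindow m u → Infix (window m) u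
  inWindow⇒infix m u len (e , e≤ , o) with r , e+r≡ ← ℕₚ.m≤n⇒∃[o]m+o≡n e≤ =
    segment (- + m) e , segment (start m e + + suc m) r , (begin
      segment (- + m) (m ℕ.+ (2 ℕ.+ m))
        ≡⟨ cong (segment (- + m)) split ⟩
      segment (- + m) (e ℕ.+ (suc m ℕ.+ r))
        ≡⟨ segment-++ (- + m) e (suc m ℕ.+ r) ⟩
      segment (- + m) e ++ segment (start m e) (suc m ℕ.+ r)
        ≡⟨ cong (segment (- + m) e ++_) (segment-++ (start m e) (suc m) r) ⟩
      segment (- + m) e ++ segment (start m e) (suc m) ++ segment (start m e + + suc m) r
        ≡⟨ cong (λ v → segment (- + m) e ++ v ++ segment (start m e + + suc m) r) u-segment ⟩
      segment (- + m) e ++ u ++ segment (start m e + + suc m) r ∎)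
    where
    open ≡-Reasoning
    u-segment : segment (start m e) (suc m) ≡ u
    u-segment = trans (cong (segment (start m e)) (sym len)) (occursAt⇒segment _ u o)
    split : m ℕ.+ (2 ℕ.+ m) ≡ e ℕ.+ (suc m ℕ.+ r)
    split = begin
      m ℕ.+ (2 ℕ.+ m)       ≡⟨ ℕₚ.+-suc m (suc m) ⟩
      suc m ℕ.+ suc m       ≡⟨ cong (ℕ._+ suc m) (sym e+r≡) ⟩
      e ℕ.+ r ℕ.+ suc m     ≡⟨ ℕₚ.+-assoc e r (suc m) ⟩
      e ℕ.+ (r ℕ.+ suc m)   ≡⟨ cong (e ℕ.+_) (ℕₚ.+-comm r (suc m)) ⟩
      e ℕ.+ (suc m ℕ.+ r)   ∎

  left≡reverse-prefix : ∀ m → left m ≡ reverse (prefix p m)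
  left≡reverse-prefix zero    = refl
  left≡reverse-prefix (suc m) = begin
    g (- + suc m) ∷ segment (- + suc m + 1ℤ) m
      ≡⟨ cong₂ _∷_ (trans (cong g (first (+ m))) (g-left m)) (cong (λ i → segment i m) (rest (+ m))) ⟩
    p m ∷ left m                       ≡⟨ cong (p m ∷_) (left≡reverse-prefix m) ⟩
    p m ∷ reverse (prefix p m)         ≡⟨ Listₚ.reverse-++ (prefix p m) (p m ∷ []) ⟨
    reverse (prefix p m ∷ʳ p m)        ≡⟨ cong reverse (Listₚ.map-++ p (upTo m) (m ∷ [])) ⟨
    reverse (map p (upTo m ∷ʳ m))      ≡⟨ cong (reverse ∘ map p) (Listₚ.upTo-∷ʳ m) ⟩
    reverse (prefix p (suc m))         ∎
    where
    open ≡-Reasoning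
    first : ∀ a → - (1ℤ + a) ≡ -1ℤ - a
    first = solve-∀
    rest : ∀ a → - (1ℤ + a) + 1ℤ ≡ - a
    rest = solve-∀

  window≡wrap : ∀ m → window m ≡ wrap (prefix p m) x y
  window≡wrap m = begin
    segment (- + m) (m ℕ.+ (2 ℕ.+ m))          ≡⟨ segment-++ (- + m) m (2 ℕ.+ m) ⟩
    left m ++ segment (- + m + + m) (2 ℕ.+ m)  ≡⟨ cong (λ i → left m ++ segment i (2 ℕ.+ m)) (ℤₚ.+-inverseˡ (+ m)) ⟩
    left m ++ g 0ℤ ∷ g 1ℤ ∷ segment (+ 2) m    ≡⟨ cong₂ _++_ (left≡reverse-prefix m) (cong₂ _∷_ g0 (cong₂ _∷_ g1 right)) ⟩
    wrap (prefix p m) x y                      ∎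
    where
    open ≡-Reasoning
    right : segment (+ 2) m ≡ prefix p m
    right = trans (segment-applyUpTo (+ 2) p m g-right) (sym (Listₚ.map-upTo p m))

  factor⇔infix-wrap : ∀ m u → length u ≡ suc m → Factor u ⇔ Infix (wrap (prefix p m) x y) u
  factor⇔infix-wrap m u len = mk⇔
    (subst (λ z → Infix z u) (window≡wrap m) ∘ inWindow⇒infix m u len ∘ factor⇒inWindow m u len)
    (infix-segment⇒factor _ _ u ∘ subst (λ z → Infix z u) (sym (window≡wrap m)))

  factor⇔infix-wrap-reversed : ∀ m u → length u ≡ suc m → Factor u ⇔ Infix (wrap (prefix p m) y x) u
  factor⇔infix-wrap-reversed m u len =
    ⇔.trans (reverse-closed⇔ u) (⇔.trans (factor⇔infix-wrap m (reverse u) (trans (Listₚ.length-reverse u) len))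
      (subst₂ (λ z v → Infix (wrap (prefix p m) x y) (reverse u) ⇔ Infix z v)
              (wrap-reverse (prefix p m) x y) (Listₚ.reverse-involutive u)
              (infix⇔reverse (wrap (prefix p m) x y) (reverse u))))

module _ {A : Set} (s : ℤ → A) (k : ℤ) where
  open Occurrences using (OccursAt; Factor)

  occursAt-shift⁺ : ∀ i l → OccursAt (λ j → s (k + j)) i l → OccursAt s (k + i) l
  occursAt-shift⁺ i []      _       = tt
  occursAt-shift⁺ i (a ∷ l) (e , o) = e , subst (λ j → OccursAt s j l) (sym (ℤₚ.+-assoc k i 1ℤ)) (occursAt-shift⁺ (i + 1ℤ) l o)

  occursAt-shift⁻ : ∀ i l → OccursAt s (k + i) l → OccursAt (λ j → s (k + j)) i l
  occursAt-shift⁻ i []      _       = tt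
  occursAt-shift⁻ i (a ∷ l) (e , o) = e , occursAt-shift⁻ (i + 1ℤ) l (subst (λ j → OccursAt s j l) (ℤₚ.+-assoc k i 1ℤ) o)

  factor-shift : ∀ l → Factor (λ j → s (k + j)) l ⇔ Factor s l
  factor-shift l = mk⇔ (λ (i , o) → k + i , occursAt-shift⁺ i l o)
    (λ (j , o) → j - k , occursAt-shift⁻ (j - k) l (subst (λ i → OccursAt s i l) (sym (k+[j-k]≡j k j)) o))
    where
    k+[j-k]≡j : ∀ k j → k + (j - k) ≡ j
    k+[j-k]≡j = solve-∀

factor⇔wraps : ∀ {s p x y} → Balanced s → Factorization s p x y → ∀ m (u : Vec Bool (suc m)) →
               (IsFactor s u ⇔ IsFinFactor (wrap (prefix p m) x y) u) × (IsFactor s u ⇔ IsFinFactor (wrap (prefix p m) y x) u)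
factor⇔wraps {s} {p} bal (x≢y , k , sk , sk1 , sides) m u =
  ⇔.trans isFactor⇔factor-g (factor⇔infix-wrap m (toList u) (Vecₚ.length-toList u)) ,
  ⇔.trans isFactor⇔factor-g (factor⇔infix-wrap-reversed m (toList u) (Vecₚ.length-toList u))
  where
  g : ℤ → Bool
  g i = s (k + i)
  open Occurrences using (Factor)
  noBadPair : NoBadPair (Factor g)
  noBadPair a z F₁ F₂ = balanced⇒noBadPair s bal a z (Equivalence.to (factor-shift s k _) F₁) (Equivalence.to (factor-shift s k _) F₂)
  g-left : ∀ i → g (-1ℤ - + i) ≡ p i
  g-left i = trans (cong s (reassoc k (+ i))) (proj₁ (sides i))
    where
    reassoc : ∀ k a → k + (-1ℤ - a) ≡ k - 1ℤ - a
    reassoc = solve-∀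
  g-right : ∀ i → g (+ 2 + + i) ≡ p i
  g-right i = trans (cong s (sym (ℤₚ.+-assoc k (+ 2) (+ i)))) (proj₂ (sides i))
  open Window g p x≢y (trans (cong s (ℤₚ.+-identityʳ k)) sk) sk1 g-left g-right noBadPair
  isFactor⇔factor-g : IsFactor s u ⇔ Factor g (toList u)
  isFactor⇔factor-g = ⇔.trans (isFactor⇔factor s u) (⇔.sym (factor-shift s k (toList u)))

orient-distinct : ∀ {A : Set} (W : Bool → Bool → Set) x y → x ≢ y → (A ⇔ W x y) × (A ⇔ W y x) →
                  (A ⇔ W false true) × (W false true ⇔ W true false)
orient-distinct W false false x≢y _                = ⊥-elim (x≢y refl)
orient-distinct W true  true  x≢y _                = ⊥-elim (x≢y refl)
orient-distinct W false true  _   (A⇔W01 , A⇔W10) = A⇔W01 , ⇔.trans (⇔.sym A⇔W01) A⇔W10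
orient-distinct W true  false _   (A⇔W10 , A⇔W01) = A⇔W01 , ⇔.trans (⇔.sym A⇔W01) A⇔W10

corollary2p6 : (s : BiSeq) (p : RSeq) (x y : Bool) → Balanced s → Factorization s p x y →
    (n : ℕ) → 1 ≤ n → (u : Vec Bool n) →
      (IsFactor s u ⇔ IsFinFactor (wrap (prefix p (n ∸ 1)) false true) u)
      × (IsFinFactor (wrap (prefix p (n ∸ 1)) false true) u ⇔ IsFinFactor (wrap (prefix p (n ∸ 1)) true false) u)
corollary2p6 s p x y bal fac (suc m) (s≤s z≤n) u =
  orient-distinct (λ a b → IsFinFactor (wrap (prefix p m) a b) u) x y (proj₁ fac) (factor⇔wraps bal fac m u)
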